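{- Let $P$ be a pre-fork with vertices $\{r,k,k'\}$. Then $P\setminus\{r\}$ is a key with vertices $\{k,k'\}$.
   Context: A quiver is a finite directed multigraph with no loops and no 2-cycles; $p_{ij}$ is the number of arrows $i\to j$ in $P$ if positive and minus the number of arrows $j\to i$ otherwise. $P\setminus V$ denotes the full subquiver on the vertices not in $V$. Abundant: at least two arrows between every pair of distinct vertices; acyclic: no directed cycle; $F^+(v)=\{j:f_{vj}>0\}$, $F^-(v)=\{j:f_{jv}>0\}$. A fork is an abundant, non-acyclic quiver $F$ with a vertex $r$ (point of return) such that for all $i\in F^-(r)$, $j\in F^+(r)$: $f_{ji}>f_{ir}$ and $f_{ji}>f_{rj}$, and the full subquivers on $F^-(r)$ and $F^+(r)$ are acyclic. A pre-fork with vertices $\{r,k,k'\}$ is a quiver $P$ with $k\ne k'$ such that $P\setminus\{k\}$ and $P\setminus\{k'\}$ are forks with common point of return $r$, and for each vertex $i\notin\{k,k'\}$ either ($k\to i$ and $k'\to i$) or ($i\to k$ and $i\to k'$), with any number (possibly zero) of arrows between $k$ and $k'$. A key with vertices $\{k,k'\}$ is a quiver $Q$ such that $Q\setminus\{k\}$ and $Q\setminus\{k'\}$ are abundant acyclic and the same condition on vertices $i\notin\{k,k'\}$ holds. -}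

module Defs where

open import Data.Nat using (ℕ)
open import Data.Fin using (Fin)
open import Data.Integer using (ℤ; -_; _<_; _≤_; ∣_∣; +_; 0ℤ)
open import Data.Product using (_×_; ∃)
open import Data.Sum using (_⊎_)
open import Data.Unit using (⊤)
open import Level using (0ℓ)
open import Relation.Nullary using (¬_)
open import Relation.Unary using (Pred)
open import Relation.Binary.PropositionalEquality using (_≡_; _≢_)
open import Relation.Binary.Construct.Closure.Transitive using (TransClosure)

-- A quiver on the vertex set Fin n, encoded by its skew-symmetric
-- exchange matrix p : p i j = #(i → j) if positive, - #(j → i) otherwise.
-- Skew-symmetry encodes "no loops" (p i i = 0) and "no 2-cycles".
record Quiver (n : ℕ) : Set where
  field
    p    : Fin n → Fin n → ℤ
    skew : ∀ i j → p j i ≡ - p i j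
open Quiver public

-- Full subquivers are given by a set of vertices S (a predicate on Fin n);
-- all notions below concern the full subquiver of Q on S.
VSet : ℕ → Set₁
VSet n = Pred (Fin n) 0ℓ

_∖_ : ∀ {n} → VSet n → Fin n → VSet n
(S ∖ v) i = S i × i ≢ v

Every : ∀ {n} → VSet n
Every _ = ⊤

Arrow : ∀ {n} → Quiver n → VSet n → Fin n → Fin n → Set
Arrow Q S i j = S i × S j × 0ℤ < p Q i j

Abundant : ∀ {n} → Quiver n → VSet n → Set
Abundant Q S = ∀ i j → S i → S j → i ≢ j → 2 Data.Nat.≤ ∣ p Q i j ∣

Acyclic : ∀ {n} → Quiver n → VSet n → Set
Acyclic Q S = ∀ i → ¬ TransClosure (Arrow Q S) i i

Out : ∀ {n} → Quiver n → VSet n → Fin n → VSet n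
Out Q S v j = S j × 0ℤ < p Q v j

In : ∀ {n} → Quiver n → VSet n → Fin n → VSet n
In Q S v j = S j × 0ℤ < p Q j v

ForkAt : ∀ {n} → Quiver n → VSet n → Fin n → Set
ForkAt Q S r =
  S r × Abundant Q S × ¬ Acyclic Q S
  × (∀ i j → In Q S r i → Out Q S r j →
        p Q i r < p Q j i × p Q r j < p Q j i)
  × Acyclic Q (In Q S r) × Acyclic Q (Out Q S r)

KeyCondition : ∀ {n} → Quiver n → VSet n → Fin n → Fin n → Set
KeyCondition Q S k k' =
  ∀ i → S i → i ≢ k → i ≢ k' →
    (0ℤ < p Q k i × 0ℤ < p Q k' i) ⊎ (0ℤ < p Q i k × 0ℤ < p Q i k')

PreFork : ∀ {n} → Quiver n → VSet n → Fin n → Fin n → Fin n → Set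
PreFork Q S r k k' =
  S k × S k' × k ≢ k'
  × ForkAt Q (S ∖ k) r × ForkAt Q (S ∖ k') r
  × KeyCondition Q S k k'

Key : ∀ {n} → Quiver n → VSet n → Fin n → Fin n → Set
Key Q S k k' =
  S k × S k' × k ≢ k'
  × (Abundant Q (S ∖ k) × Acyclic Q (S ∖ k))
  × (Abundant Q (S ∖ k') × Acyclic Q (S ∖ k'))
  × KeyCondition Q S k k'

{-# OPTIONS --safe #-}
-- Deleting the point of return r from a fork F leaves an acyclic quiver.
-- By abundance every other vertex is joined to r, so it lies in F⁻(r) or
-- in F⁺(r); and an arrow i → j with i ∈ F⁻(r), j ∈ F⁺(r) is impossible,
-- since f_ji > f_ir > 0.  Hence a cycle through a vertex of F⁻(r) never
-- leaves F⁻(r), a cycle through a vertex of F⁺(r) never leaves F⁺(r), and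
-- both are acyclic.  For the pre-fork P, the quivers P ∖ {r,k} and
-- P ∖ {r,k'} are such forks minus r; abundance and the key condition are
-- inherited by subquivers.
module Submission where

open import Defs
open import Data.Nat using (ℕ)
import Data.Nat as ℕ
open import Data.Fin using (Fin)
open import Data.Integer using (_<_; 0ℤ; ∣_∣)
open import Data.Integer.Properties using (<-cmp; <-trans; <-asym; neg-mono-<)
open import Data.Product using (_×_; _,_; proj₁; proj₂)
open import Data.Sum using (inj₁; inj₂)
open import Data.Unit using (tt)
open import Data.Empty using (⊥-elim)
open import Function using (_∘_)
open import Relation.Nullary using (¬_)
open import Relation.Unary using (_⊆_; _∪_)
open import Relation.Binary using (tri<; tri≈; tri>)
open import Relation.Binary.PropositionalEquality using (_≢_; sym; subst)
open import Relation.Binary.Construct.Closure.Transitive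
  using (TransClosure; [_]; _∷_)

module _ {n : ℕ} (Q : Quiver n) where

  private
    Path : VSet n → Fin n → Fin n → Set
    Path S = TransClosure (Arrow Q S)

  path-source : ∀ {S x y} → Path S x y → S x
  path-source [ Sx , _ ] = Sx
  path-source ((Sx , _) ∷ _) = Sx

  Path-mono : ∀ {S T} → S ⊆ T → ∀ {x y} → Path S x y → Path T x y
  Path-mono S⊆T [ Sx , Sy , x→y ] = [ S⊆T Sx , S⊆T Sy , x→y ]
  Path-mono S⊆T ((Sx , Sz , x→z) ∷ z→⁺y) =
    (S⊆T Sx , S⊆T Sz , x→z) ∷ Path-mono S⊆T z→⁺y

  Acyclic-antimono : ∀ {S T} → S ⊆ T → Acyclic Q T → Acyclic Q S
  Acyclic-antimono S⊆T acyclic i = acyclic i ∘ Path-mono S⊆T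

  Abundant-antimono : ∀ {S T} → S ⊆ T → Abundant Q T → Abundant Q S
  Abundant-antimono S⊆T abundant i j Si Sj = abundant i j (S⊆T Si) (S⊆T Sj)

  ForwardClosed : VSet n → VSet n → Set
  ForwardClosed S A = ∀ {x y} → A x → Arrow Q S x y → A y

  BackwardClosed : VSet n → VSet n → Set
  BackwardClosed S B = ∀ {x y} → B y → Arrow Q S x y → B x

  path-forwardClosed : ∀ {S A} → ForwardClosed S A →
    ∀ {x y} → A x → Path S x y → Path A x y
  path-forwardClosed closed Ax [ x→y ] =
    [ Ax , closed Ax x→y , proj₂ (proj₂ x→y) ]
  path-forwardClosed closed Ax (x→z ∷ z→⁺y) =
    (Ax , Az , proj₂ (proj₂ x→z)) ∷ path-forwardClosed closed Az z→⁺y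
    where Az = closed Ax x→z

  path-backwardClosed : ∀ {S B} → BackwardClosed S B →
    ∀ {x y} → B y → Path S x y → Path B x y
  path-backwardClosed closed By [ x→y ] =
    [ closed By x→y , By , proj₂ (proj₂ x→y) ]
  path-backwardClosed closed By (x→z ∷ z→⁺y) =
    (closed Bz x→z , Bz , proj₂ (proj₂ x→z)) ∷ z→⁺B
    where
    z→⁺B = path-backwardClosed closed By z→⁺y
    Bz = path-source z→⁺B

  Acyclic-split : ∀ {S A B} → S ⊆ A ∪ B →
    ForwardClosed S A → BackwardClosed S B →
    Acyclic Q A → Acyclic Q B → Acyclic Q S
  Acyclic-split S⊆A∪B closedA closedB acyclicA acyclicB i cycle
    with S⊆A∪B (path-source cycle)
  ... | inj₁ Ai = acyclicA i (path-forwardClosed closedA Ai cycle)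
  ... | inj₂ Bi = acyclicB i (path-backwardClosed closedB Bi cycle)

  In∪Out : ∀ {F r} → F r → Abundant Q F → F ∖ r ⊆ In Q F r ∪ Out Q F r
  In∪Out {F} {r} Fr abundant {j} (Fj , j≢r) with <-cmp 0ℤ (p Q r j)
  ... | tri< 0<rj _ _ = inj₂ (Fj , 0<rj)
  ... | tri≈ _ 0≡rj _ = ⊥-elim (2≰∣0∣ (abundant r j Fr Fj (j≢r ∘ sym)))
    where
    2≰∣0∣ : ¬ 2 ℕ.≤ ∣ p Q r j ∣
    2≰∣0∣ rewrite sym 0≡rj = λ ()
  ... | tri> _ _ rj<0 =
    inj₁ (Fj , subst (0ℤ <_) (sym (skew Q r j)) (neg-mono-< rj<0))

  module _ {F : VSet n} {r : Fin n} (fork : ForkAt Q F r) where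

    private
      Fr = proj₁ fork
      abundant = proj₁ (proj₂ fork)
      returns = proj₁ (proj₂ (proj₂ (proj₂ fork)))
      acyclicIn = proj₁ (proj₂ (proj₂ (proj₂ (proj₂ fork))))
      acyclicOut = proj₂ (proj₂ (proj₂ (proj₂ (proj₂ fork))))

    no-arrow-In→Out : ∀ {i j} → In Q F r i → Out Q F r j → ¬ 0ℤ < p Q i j
    no-arrow-In→Out {i} {j} Ini@(_ , 0<ir) Outj 0<ij =
      <-asym 0<ji (subst (_< 0ℤ) (sym (skew Q i j)) (neg-mono-< 0<ij))
      where
      0<ji : 0ℤ < p Q j i
      0<ji = <-trans 0<ir (proj₁ (returns i j Ini Outj))

    In-forwardClosed : ForwardClosed (F ∖ r) (In Q F r)
    In-forwardClosed Inx (_ , F∖ry , x→y) with In∪Out Fr abundant F∖ry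
    ... | inj₁ Iny = Iny
    ... | inj₂ Outy = ⊥-elim (no-arrow-In→Out Inx Outy x→y)

    Out-backwardClosed : BackwardClosed (F ∖ r) (Out Q F r)
    Out-backwardClosed Outy (F∖rx , _ , x→y) with In∪Out Fr abundant F∖rx
    ... | inj₁ Inx = ⊥-elim (no-arrow-In→Out Inx Outy x→y)
    ... | inj₂ Outx = Outx

    fork∖return-acyclic : Acyclic Q (F ∖ r)
    fork∖return-acyclic =
      Acyclic-split (In∪Out Fr abundant) In-forwardClosed Out-backwardClosed
        acyclicIn acyclicOut

∖-swap : ∀ {n} {S : VSet n} {u v} → (S ∖ u) ∖ v ⊆ (S ∖ v) ∖ u
∖-swap ((Sx , x≢u) , x≢v) = (Sx , x≢v) , x≢u

∖-⊆ : ∀ {n} {S : VSet n} {v} → S ∖ v ⊆ S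
∖-⊆ = proj₁

lemma4p8 : ∀ {n} (P : Quiver n) (r k k' : Fin n) →
    PreFork P Every r k k' → Key P (Every ∖ r) k k'
lemma4p8 P r k k' (_ , _ , k≢k' , fork∖k , fork∖k' , keyCondition) =
  (tt , ≢r fork∖k) , (tt , ≢r fork∖k') , k≢k'
  , minus-r-abundant-acyclic fork∖k
  , minus-r-abundant-acyclic fork∖k'
  , λ i _ → keyCondition i tt
  where
  ≢r : ∀ {v} → ForkAt P (Every ∖ v) r → v ≢ r
  ≢r fork v≡r = proj₂ (proj₁ fork) (sym v≡r)

  minus-r-abundant-acyclic : ∀ {v} → ForkAt P (Every ∖ v) r →
    Abundant P ((Every ∖ r) ∖ v) × Acyclic P ((Every ∖ r) ∖ v)
  minus-r-abundant-acyclic {v} fork =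
    Abundant-antimono P (∖-⊆ {S = Every ∖ v} ∘ ∖-swap) (proj₁ (proj₂ fork)) ,
    Acyclic-antimono P ∖-swap (fork∖return-acyclic P fork)
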